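{- Let $R$ be a finite convergent, right-reduced, and forward-closed string rewriting system over a finite alphabet $\Sigma$, let $u, v \in IRR(R)$, and let $\# \notin \Sigma$. Then the language $$\mathcal{L}_{u,v} = \{\, w\# \;:\; w \in \Sigma^*,\ w \neq \lambda,\ uw \to_R^! v \,\}$$ is a deterministic context-free language over $(\Sigma \cup \{\#\})^*$.
   Context: A string rewriting system $R$ over $\Sigma$ is a set of rules $l\to r$ ($l,r\in\Sigma^*$) with rewrite relation $xly\to_R xry$; $IRR(R)$ is the set of irreducible strings; $w\to_R^! w'$ means $w\to_R^* w'$ with $w'$ irreducible; $\lambda$ is the empty string. $R$ is convergent if terminating and confluent; right-reduced if every right-hand side is irreducible. A redex is a string $wl$ with $l$ a left-hand side; it is innermost if no proper prefix is a redex; $R$ is forward-closed if every innermost redex reduces to its normal form in one step. -}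

module Defs where

open import Data.Nat using (ℕ; suc)
open import Data.Fin using (Fin)
open import Data.List using (List; []; _∷_; _++_; map; [_])
open import Data.List.Membership.Propositional using (_∈_)
open import Data.Product using (Σ; ∃; ∃-syntax; _×_; _,_)
open import Data.Sum using (_⊎_; inj₁; inj₂)
open import Data.Unit using (⊤; tt)
open import Data.Bool using (Bool; true)
open import Data.Maybe using (Maybe; just; nothing; Is-just)
open import Relation.Binary.PropositionalEquality using (_≡_; _≢_)
open import Relation.Binary.Construct.Closure.ReflexiveTransitive using (Star)
open import Relation.Nullary using (¬_)
open import Induction.WellFounded using (WellFounded)
open import Function.Bundles using (_⇔_)

Str : ℕ → Set
Str k = List (Fin k)

Rule : ℕ → Set
Rule k = Str k × Str k

SRS : ℕ → Set
SRS k = List (Rule k)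

module _ {k : ℕ} (R : SRS k) where

  data _⟶_ : Str k → Str k → Set where
    rewr : ∀ x y l r → (l , r) ∈ R → (x ++ l ++ y) ⟶ (x ++ r ++ y)

  _⟶*_ : Str k → Str k → Set
  _⟶*_ = Star _⟶_

  Irreducible : Str k → Set
  Irreducible w = ∀ w' → ¬ (w ⟶ w')

  _⟶!_ : Str k → Str k → Set
  w ⟶! w' = (w ⟶* w') × Irreducible w'

  Terminating : Set
  Terminating = WellFounded (λ y x → x ⟶ y)

  Confluent : Set
  Confluent = ∀ w w₁ w₂ → w ⟶* w₁ → w ⟶* w₂ → ∃[ w₃ ] ((w₁ ⟶* w₃) × (w₂ ⟶* w₃))

  Convergent : Set
  Convergent = Terminating × Confluent

  RightReduced : Set
  RightReduced = ∀ l r → (l , r) ∈ R → Irreducible r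

  Redex : Str k → Set
  Redex x = ∃[ w ] ∃[ l ] ∃[ r ] (((l , r) ∈ R) × (x ≡ w ++ l))

  InnermostRedex : Str k → Set
  InnermostRedex x = Redex x × (∀ p q → x ≡ p ++ q → q ≢ [] → ¬ Redex p)

  ForwardClosed : Set
  ForwardClosed = ∀ x → InnermostRedex x → ∃[ y ] ((x ⟶ y) × Irreducible y)

record DPDA (A : Set) : Set₁ where
  field
    nQ nΓ : ℕ
    start : Fin nQ
    Z₀    : Fin nΓ
    final : Fin nQ → Bool
    δ     : Fin nQ → Maybe A → Fin nΓ → Maybe (Fin nQ × List (Fin nΓ))
    deterministic : ∀ q Z → Is-just (δ q nothing Z) → ∀ a → δ q (just a) Z ≡ nothing

  Config : Set
  Config = Fin nQ × List A × List (Fin nΓ)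

  data _⊢_ : Config → Config → Set where
    read : ∀ {q q' a w Z s γ} → δ q (just a) Z ≡ just (q' , γ) →
           (q , a ∷ w , Z ∷ s) ⊢ (q' , w , γ ++ s)
    eps  : ∀ {q q' w Z s γ} → δ q nothing Z ≡ just (q' , γ) →
           (q , w , Z ∷ s) ⊢ (q' , w , γ ++ s)

  Accepts : List A → Set
  Accepts w = ∃[ q ] ∃[ s ] (Star _⊢_ (start , w , Z₀ ∷ []) (q , [] , s) × final q ≡ true)

Language : Set → Set₁
Language A = List A → Set

IsDCFL : {A : Set} → Language A → Set₁
IsDCFL {A} L = Σ (DPDA A) λ M → ∀ w → L w ⇔ DPDA.Accepts M w

L[_,_,_] : ∀ {k} → SRS k → Str k → Str k → Language (Fin k ⊎ ⊤)
L[ R , u , v ] x = ∃[ w ] ((x ≡ map inj₁ w ++ [ inj₂ tt ]) × (w ≢ []) × _⟶!_ R (u ++ w) v)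

-- A recogniser keeps the normal form of u w (w the input read so far) split into a
-- stack and a buffer holding a suffix of bounded length. If x is irreducible, a rewrite of x a
-- is an innermost redex at its end, so by forward closure one step yields the normal form of x a;
-- once the buffer is at least as long as every left-hand side (or the stack is empty) this step
-- happens inside the buffer, and by confluence its result does not depend on the stack. Reading a
-- letter is therefore a finite-state update of the buffer, followed by spilling the excess onto the
-- stack and refilling the buffer from it; after # the stack is unloaded into the buffer until it
-- can be compared with v.
module Submission where

open import Defs
open import Data.Nat using (ℕ; zero; suc; _+_; _*_; _∸_; _≤_; _<_; s≤s; z≤n; _<?_)
open import Data.Nat.Properties
  using (≤-trans; ≤-total; ≤-reflexive; m≤m+n; m≤n+m; ≮⇒≥; <⇒≱; ≤⇒≯
        ; m∸[m∸n]≡n; m≤n⇒m∸n≡0)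
open import Data.Fin using (Fin; zero; suc; combine; remQuot)
open import Data.Fin.Properties using (remQuot-combine)
import Data.Fin.Properties as Fin
open import Data.List using (List; []; _∷_; _++_; _∷ʳ_; [_]; length; map; reverse; take; drop)
open import Data.List.Properties
  using ( ++-assoc; ++-identityʳ; ++-conicalˡ; ++-conicalʳ; ∷-injective; ∷ʳ-injectiveˡ; ∷ʳ-++; length-++
        ; length-drop; take++drop≡id; map-++; map-injective; reverse-++; reverse-involutive; unfold-reverse; ≡-dec)
open import Data.List.Reverse using (Reverse; []; _∶_∶ʳ_; reverseView)
open import Data.List.Membership.Propositional using (_∈_; find; lose)
open import Data.List.Relation.Unary.Any using (Any; any?)
import Data.List.Relation.Unary.All as All
open import Data.List.Relation.Binary.Suffix.Heterogeneous using (Suffix)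
open import Data.List.Relation.Binary.Suffix.Heterogeneous.Properties using (suffix?)
open import Data.List.Relation.Binary.Suffix.Propositional.Properties using (Suffix-as-∣ʳ; ∣ʳ-as-Suffix)
open import Data.List.Extrema.Nat using (argmax; f[xs]≤f[argmax])
open import Algebra.Definitions.RawMagma using (_,_)
open import Data.Product using (∃-syntax; _×_; _,_; proj₁; proj₂)
import Data.Product as Product
open import Data.Sum using (_⊎_; inj₁; inj₂)
import Data.Sum as Sum
open import Data.Sum.Properties using (inj₁-injective)
open import Data.Unit using (⊤; tt)
open import Data.Empty using (⊥; ⊥-elim)
open import Data.Bool using (Bool; true; false)
open import Data.Maybe using (Maybe; just; nothing; Is-just)
import Data.Maybe as Maybe
open import Data.Maybe.Relation.Unary.Any using () renaming (just to is-just)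
open import Function using (_∘_)
open import Function.Bundles using (_⇔_; mk⇔; Equivalence)
open import Relation.Nullary using (¬_; Dec; yes; no)
import Relation.Nullary.Decidable as Dec
open import Relation.Binary.PropositionalEquality hiding ([_])
open import Relation.Binary.Construct.Closure.ReflexiveTransitive using (Star; ε; _◅_; _◅◅_; gmap)

module _ {A : Set} where

  ++-∷ʳ-split : ∀ (p q x : List A) a → p ++ q ≡ x ∷ʳ a →
                q ≡ [] ⊎ ∃[ q' ] (x ≡ p ++ q' × q ≡ q' ∷ʳ a)
  ++-∷ʳ-split []       []      x       a _  = inj₁ refl
  ++-∷ʳ-split []       (_ ∷ _) x       a eq = inj₂ (x , refl , eq)
  ++-∷ʳ-split (_ ∷ []) []      []      a refl = inj₁ refl
  ++-∷ʳ-split (_ ∷ p)  q       (_ ∷ x) a eq with refl , eq' ← ∷-injective eq with ++-∷ʳ-split p q x a eq'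
  ... | inj₁ q≡[]               = inj₁ q≡[]
  ... | inj₂ (q' , refl , q≡) = inj₂ (q' , refl , q≡)

  ++-split-at-suffix : ∀ (s t x l : List A) → s ++ t ≡ x ++ l → length l ≤ length t →
                       ∃[ c ] (t ≡ c ++ l × x ≡ s ++ c)
  ++-split-at-suffix []      t x       l eq _ = x , eq , refl
  ++-split-at-suffix (a ∷ s) t []      l eq l≤t =
    ⊥-elim (<⇒≱ (subst (length t <_) (cong length eq) t<as++t) l≤t)
    where
      t<as++t : length t < length (a ∷ s ++ t)
      t<as++t = s≤s (subst (length t ≤_) (sym (length-++ s)) (m≤n+m _ _))
  ++-split-at-suffix (_ ∷ s) t (_ ∷ x) l eq l≤t with refl , eq' ← ∷-injective eq
    with c , t≡ , x≡ ← ++-split-at-suffix s t x l eq' l≤t = c , t≡ , cong (_ ∷_) x≡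

  length≤length-∷ʳ : ∀ (b : List A) {a} → length b ≤ length (b ∷ʳ a)
  length≤length-∷ʳ b = subst (length b ≤_) (sym (length-++ b)) (m≤m+n _ _)

  ∷ʳ≢[] : ∀ (w : List A) {a} → w ∷ʳ a ≢ []
  ∷ʳ≢[] w eq with () ← ++-conicalʳ w _ eq

m∸[m∸n]≤n : ∀ m n → m ∸ (m ∸ n) ≤ n
m∸[m∸n]≤n m n with ≤-total n m
... | inj₁ n≤m = ≤-reflexive (m∸[m∸n]≡n n≤m)
... | inj₂ m≤n = subst (_≤ n) (sym (cong (m ∸_) (m≤n⇒m∸n≡0 m≤n))) m≤n

module _ {P B : Set} where

  when : Dec P → Maybe B → Maybe B
  when (yes _) m = m
  when (no _)  _ = nothing

  when-just : ∀ (p? : Dec P) {m o} → when p? m ≡ just o → P × m ≡ just o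
  when-just (yes p) eq = p , eq

  when-is-just : ∀ (p? : Dec P) {m} → Is-just (when p? m) → P
  when-is-just (yes p) _ = p

  when-holds : ∀ (p? : Dec P) {m} → P → when p? m ≡ m
  when-holds (yes _) _ = refl
  when-holds (no ¬p) p = ⊥-elim (¬p p)

  unless : Dec P → Maybe B → Maybe B
  unless (yes _) _ = nothing
  unless (no _)  m = m

  unless-just : ∀ (p? : Dec P) {m o} → unless p? m ≡ just o → ¬ P × m ≡ just o
  unless-just (no ¬p) eq = ¬p , eq

  unless-holds : ∀ (p? : Dec P) {m} → P → unless p? m ≡ nothing
  unless-holds (yes _) _ = refl
  unless-holds (no ¬p) p = ⊥-elim (¬p p)

  unless-fails : ∀ (p? : Dec P) {m} → ¬ P → unless p? m ≡ m
  unless-fails (yes p) ¬p = ⊥-elim (¬p p)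
  unless-fails (no _)  _  = refl

module BoundedLists (k : ℕ) where

  -- 1 + k + k² + ⋯ + k^N, the number of lists of length at most N
  codeSize : ℕ → ℕ
  codeSize zero    = 1
  codeSize (suc N) = suc (k * codeSize N)

  encodeList : ∀ N → List (Fin k) → Fin (codeSize N)
  encodeList zero    _       = zero
  encodeList (suc N) []      = zero
  encodeList (suc N) (a ∷ t) = suc (combine a (encodeList N t))

  decodeList : ∀ N → Fin (codeSize N) → List (Fin k)
  decodeList zero    _       = []
  decodeList (suc N) zero    = []
  decodeList (suc N) (suc i) =
    proj₁ (remQuot {k} (codeSize N) i) ∷ decodeList N (proj₂ (remQuot {k} (codeSize N) i))

  decodeList-encodeList : ∀ N t → length t ≤ N → decodeList N (encodeList N t) ≡ t
  decodeList-encodeList zero    []      _         = refl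
  decodeList-encodeList (suc N) []      _         = refl
  decodeList-encodeList (suc N) (a ∷ t) (s≤s t≤N) =
    trans (cong (λ (b , j) → b ∷ decodeList N j) (remQuot-combine {k} {codeSize N} a (encodeList N t)))
          (cong (a ∷_) (decodeList-encodeList N t t≤N))

record AbstractDPDA (A : Set) : Set₁ where
  field
    State : Set
    nΓ    : ℕ
    start : State
    Z₀    : Fin nΓ
    final : State → Bool
    δ     : State → Maybe A → Fin nΓ → Maybe (State × List (Fin nΓ))
    deterministic : ∀ q Z → Is-just (δ q nothing Z) → ∀ a → δ q (just a) Z ≡ nothing

  Config : Set
  Config = State × List A × List (Fin nΓ)

  data _⊢_ : Config → Config → Set where
    read : ∀ {q q' a w Z s γ} → δ q (just a) Z ≡ just (q' , γ) →
           (q , a ∷ w , Z ∷ s) ⊢ (q' , w , γ ++ s)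
    eps  : ∀ {q q' w Z s γ} → δ q nothing Z ≡ just (q' , γ) →
           (q , w , Z ∷ s) ⊢ (q' , w , γ ++ s)

  Accepts : List A → Set
  Accepts w = ∃[ q ] ∃[ s ] (Star _⊢_ (start , w , Z₀ ∷ []) (q , [] , s) × final q ≡ true)

record FinitePresentation {A : Set} (M : AbstractDPDA A) : Set₁ where
  open AbstractDPDA M
  field
    Bounded : State → Set
    size    : ℕ
    encode  : State → Fin size
    decode  : Fin size → State
    decode-encode : ∀ {q} → Bounded q → decode (encode q) ≡ q
    start-bounded : Bounded start
    δ-bounded     : ∀ {q m Z q' γ} → Bounded q → δ q m Z ≡ just (q' , γ) → Bounded q'

module _ {A : Set} (M : AbstractDPDA A) (P : FinitePresentation M) where

  open AbstractDPDA M
  open FinitePresentation P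

  δᶠ : Fin size → Maybe A → Fin nΓ → Maybe (Fin size × List (Fin nΓ))
  δᶠ q m Z = Maybe.map (Product.map₁ encode) (δ (decode q) m Z)

  toDPDA : DPDA A
  toDPDA = record
    { nQ = size ; nΓ = nΓ ; start = encode start ; Z₀ = Z₀ ; final = final ∘ decode
    ; δ = δᶠ ; deterministic = deterministicᶠ }
    where
      deterministicᶠ : ∀ q Z → Is-just (δᶠ q nothing Z) → ∀ a → δᶠ q (just a) Z ≡ nothing
      deterministicᶠ q Z _ a with δ (decode q) nothing Z in eq
      ... | just _ rewrite deterministic (decode q) Z (subst Is-just (sym eq) (is-just _)) a = refl

  open DPDA toDPDA using () renaming (_⊢_ to _⊢ᶠ_; read to readᶠ; eps to epsᶠ)

  encodeConfig : Config → DPDA.Config toDPDA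
  encodeConfig (q , w , s) = encode q , w , s

  BoundedConfig : Config → Set
  BoundedConfig (q , _ , _) = Bounded q

  δᶠ-encode : ∀ {q m Z q' γ} → Bounded q → δ q m Z ≡ just (q' , γ) →
              δᶠ (encode q) m Z ≡ just (encode q' , γ)
  δᶠ-encode {q} {m} {Z} bounded eq =
    cong (Maybe.map (Product.map₁ encode)) (trans (cong (λ p → δ p m Z) (decode-encode bounded)) eq)

  δᶠ-decode : ∀ {q m Z q' γ} → Bounded q → δᶠ (encode q) m Z ≡ just (q' , γ) →
              ∃[ p ] (q' ≡ encode p × δ q m Z ≡ just (p , γ))
  δᶠ-decode {q} {m} {Z} bounded eq
    with δ q m Z | subst (λ p → Maybe.map (Product.map₁ encode) (δ p m Z) ≡ _) (decode-encode bounded) eq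
  ... | just (p , _) | refl = p , refl , refl

  ⊢-encode : ∀ {c c'} → BoundedConfig c → c ⊢ c' → encodeConfig c ⊢ᶠ encodeConfig c' × BoundedConfig c'
  ⊢-encode bounded (read eq) = readᶠ (δᶠ-encode bounded eq) , δ-bounded bounded eq
  ⊢-encode bounded (eps eq)  = epsᶠ (δᶠ-encode bounded eq) , δ-bounded bounded eq

  ⊢-decode : ∀ {c d} → BoundedConfig c → encodeConfig c ⊢ᶠ d →
             ∃[ c' ] (d ≡ encodeConfig c' × BoundedConfig c' × c ⊢ c')
  ⊢-decode {_ , _ ∷ _ , _ ∷ _} bounded (readᶠ eq) with _ , refl , eq' ← δᶠ-decode bounded eq =
    _ , refl , δ-bounded bounded eq' , read eq'
  ⊢-decode {_ , _ , _ ∷ _} bounded (epsᶠ eq) with _ , refl , eq' ← δᶠ-decode bounded eq =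
    _ , refl , δ-bounded bounded eq' , eps eq'

  ⊢*-encode : ∀ {c c'} → BoundedConfig c → Star _⊢_ c c' →
              Star _⊢ᶠ_ (encodeConfig c) (encodeConfig c') × BoundedConfig c'
  ⊢*-encode bounded ε = ε , bounded
  ⊢*-encode bounded (step ◅ steps) with stepᶠ , bounded₁ ← ⊢-encode bounded step
    with stepsᶠ , bounded₂ ← ⊢*-encode bounded₁ steps = stepᶠ ◅ stepsᶠ , bounded₂

  ⊢*-decode : ∀ {c d} → BoundedConfig c → Star _⊢ᶠ_ (encodeConfig c) d →
              ∃[ c' ] (d ≡ encodeConfig c' × BoundedConfig c' × Star _⊢_ c c')
  ⊢*-decode bounded ε = _ , refl , bounded , ε
  ⊢*-decode bounded (stepᶠ ◅ stepsᶠ) with _ , refl , bounded₁ , step ← ⊢-decode bounded stepᶠ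
    with _ , refl , bounded₂ , steps ← ⊢*-decode bounded₁ stepsᶠ = _ , refl , bounded₂ , step ◅ steps

  toDPDA-accepts : ∀ w → Accepts w ⇔ DPDA.Accepts toDPDA w
  toDPDA-accepts w = mk⇔ to from
    where
      to : Accepts w → DPDA.Accepts toDPDA w
      to (q , s , run , final-q) with runᶠ , bounded ← ⊢*-encode start-bounded run =
        encode q , s , runᶠ , trans (cong final (decode-encode bounded)) final-q
      from : DPDA.Accepts toDPDA w → Accepts w
      from (_ , s , runᶠ , final-q) with (q , _ , _) , refl , bounded , run ← ⊢*-decode start-bounded runᶠ =
        q , s , run , trans (cong final (sym (decode-encode bounded))) final-q

module StringRewriting {k : ℕ} (R : SRS k) where

  infix 4 _⟶ᴿ_ _⟶ᴿ*_ _⟶ᴿ!_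

  _⟶ᴿ_ : Str k → Str k → Set
  _⟶ᴿ_ = _⟶_ R

  _⟶ᴿ*_ : Str k → Str k → Set
  _⟶ᴿ*_ = _⟶*_ R

  _⟶ᴿ!_ : Str k → Str k → Set
  _⟶ᴿ!_ = _⟶!_ R

  Irr : Str k → Set
  Irr = Irreducible R

  ⟶-view : ∀ {s t} → s ⟶ᴿ t →
           ∃[ p ] ∃[ q ] ∃[ l ] ∃[ r ] ((l , r) ∈ R × s ≡ p ++ l ++ q × t ≡ p ++ r ++ q)
  ⟶-view (rewr p q l r lr∈R) = p , q , l , r , lr∈R , refl , refl

  ⟶-++ˡ : ∀ p {t t'} → t ⟶ᴿ t' → p ++ t ⟶ᴿ p ++ t'
  ⟶-++ˡ p (rewr x y l r lr∈R) =
    subst₂ _⟶ᴿ_ (++-assoc p x _) (++-assoc p x _) (rewr (p ++ x) y l r lr∈R)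

  ⟶-++ʳ : ∀ z {t t'} → t ⟶ᴿ t' → t ++ z ⟶ᴿ t' ++ z
  ⟶-++ʳ z (rewr x y l r lr∈R) = subst₂ _⟶ᴿ_ (reassoc l) (reassoc r) (rewr x (y ++ z) l r lr∈R)
    where
      reassoc : ∀ m → x ++ m ++ y ++ z ≡ (x ++ m ++ y) ++ z
      reassoc m = sym (trans (++-assoc x _ z) (cong (x ++_) (++-assoc m y z)))

  ⟶-∷ʳ-++ˡ : ∀ s {b a y} → b ∷ʳ a ⟶ᴿ y → (s ++ b) ∷ʳ a ⟶ᴿ s ++ y
  ⟶-∷ʳ-++ˡ s {b} {a} step = subst (_⟶ᴿ _) (sym (++-assoc s b [ a ])) (⟶-++ˡ s step)

  ⟶*-++ʳ : ∀ z {t t'} → t ⟶ᴿ* t' → t ++ z ⟶ᴿ* t' ++ z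
  ⟶*-++ʳ z = gmap (_++ z) (⟶-++ʳ z)

  irreducible-++⁻ˡ : ∀ p t → Irr (p ++ t) → Irr p
  irreducible-++⁻ˡ p t irr _ step = irr _ (⟶-++ʳ t step)

  irreducible-++⁻ʳ : ∀ p t → Irr (p ++ t) → Irr t
  irreducible-++⁻ʳ p t irr _ step = irr _ (⟶-++ˡ p step)

  irreducible-⟶*⇒≡ : ∀ {t z} → Irr t → t ⟶ᴿ* z → t ≡ z
  irreducible-⟶*⇒≡ irr ε          = refl
  irreducible-⟶*⇒≡ irr (step ◅ _) = ⊥-elim (irr _ step)

  normalForm-unique : Confluent R → ∀ {t y y'} → t ⟶ᴿ* y → t ⟶ᴿ* y' → Irr y → Irr y' → y ≡ y'
  normalForm-unique conf {t} {y} {y'} t⟶y t⟶y' irr irr' with _ , y⟶z , y'⟶z ← conf t y y' t⟶y t⟶y' =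
    trans (irreducible-⟶*⇒≡ irr y⟶z) (sym (irreducible-⟶*⇒≡ irr' y'⟶z))

  redex-prefix⇒reducible : ∀ {x} p q → x ≡ p ++ q → Redex R p → ¬ Irr x
  redex-prefix⇒reducible p q refl (w , l , r , lr∈R , refl) irr =
    irr _ (subst (_⟶ᴿ w ++ r ++ q) (sym (++-assoc w l q)) (rewr w q l r lr∈R))

  EndStep : Str k → Str k → Set
  EndStep s t = ∃[ x ] ∃[ l ] ∃[ r ] ((l , r) ∈ R × s ≡ x ++ l × t ≡ x ++ r)

  endStep⇒step : ∀ {s t} → EndStep s t → s ⟶ᴿ t
  endStep⇒step (x , l , r , lr∈R , refl , refl) =
    subst₂ _⟶ᴿ_ (cong (x ++_) (++-identityʳ l)) (cong (x ++_) (++-identityʳ r)) (rewr x [] l r lr∈R)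

  endStep⇒redex : ∀ {s t} → EndStep s t → Redex R s
  endStep⇒redex (x , l , r , lr∈R , s≡ , _) = x , l , r , lr∈R , s≡

  ∷ʳ-step⇒endStep : ∀ {x a t} → Irr x → x ∷ʳ a ⟶ᴿ t → EndStep (x ∷ʳ a) t
  ∷ʳ-step⇒endStep {x} {a} irr step with p , q , l , r , lr∈R , s≡ , refl ← ⟶-view step
    with ++-∷ʳ-split (p ++ l) q x a (trans (++-assoc p l q) (sym s≡))
  ... | inj₁ refl = p , l , r , lr∈R , trans s≡ (cong (p ++_) (++-identityʳ l)) , cong (p ++_) (++-identityʳ r)
  ... | inj₂ (q' , x≡ , _) = ⊥-elim (redex-prefix⇒reducible (p ++ l) q' x≡ (p , l , r , lr∈R , refl) irr)

  irreducible-∷ʳ : ∀ {x a} → Irr x → ¬ Redex R (x ∷ʳ a) → Irr (x ∷ʳ a)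
  irreducible-∷ʳ irr ¬redex _ step = ¬redex (endStep⇒redex (∷ʳ-step⇒endStep irr step))

  ∷ʳ-redex⇒innermost : ∀ {x a} → Irr x → Redex R (x ∷ʳ a) → InnermostRedex R (x ∷ʳ a)
  ∷ʳ-redex⇒innermost {x} {a} irr redex = redex , proper-prefix-irreducible
    where
      proper-prefix-irreducible : ∀ p q → x ∷ʳ a ≡ p ++ q → q ≢ [] → ¬ Redex R p
      proper-prefix-irreducible p q eq q≢[] with ++-∷ʳ-split p q x a (sym eq)
      ... | inj₁ q≡[]          = ⊥-elim (q≢[] q≡[])
      ... | inj₂ (q' , x≡ , _) = λ redex-p → redex-prefix⇒reducible p q' x≡ redex-p irr

  redex? : (x : Str k) → Dec (Redex R x)
  redex? x = Dec.map′ fromAny toAny (any? (λ lr → suffix? Fin._≟_ (proj₁ lr) x) R)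
    where
      LhsSuffix : Rule k → Set
      LhsSuffix (l , _) = Suffix _≡_ l x
      fromAny : Any LhsSuffix R → Redex R x
      fromAny any with (l , r) , lr∈R , l-suffix ← find any
        with w , w++l≡x ← Suffix-as-∣ʳ l-suffix = w , l , r , lr∈R , sym w++l≡x
      toAny : Redex R x → Any LhsSuffix R
      toAny (w , l , r , lr∈R , x≡) = lose lr∈R (∣ʳ-as-Suffix (w , sym x≡))

  irreducible-[] : ¬ Redex R [] → Irr []
  irreducible-[] ¬redex _ step with p , q , l , r , lr∈R , s≡ , _ ← ⟶-view step =
    ¬redex (subst (Redex R) (++-conicalˡ (p ++ l) q (trans (++-assoc p l q) (sym s≡))) (p , l , r , lr∈R , refl))

  irreducible? : (x : Str k) → Dec (Irr x)
  irreducible? x = decide (reverseView x)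
    where
      decide : ∀ {x} → Reverse x → Dec (Irr x)
      decide [] = Dec.map′ irreducible-[] (λ irr redex → redex-prefix⇒reducible [] [] refl redex irr)
                           (Dec.¬? (redex? []))
      decide (x ∶ view ∶ʳ a) with decide view | redex? (x ∷ʳ a)
      ... | no ¬irr | _         = no (¬irr ∘ irreducible-++⁻ˡ x [ a ])
      ... | yes irr | yes redex = no (redex-prefix⇒reducible (x ∷ʳ a) [] (sym (++-identityʳ _)) redex)
      ... | yes irr | no ¬redex = yes (irreducible-∷ʳ irr ¬redex)

  maxLhsLength : ℕ
  maxLhsLength = length (proj₁ (argmax (length ∘ proj₁) ([] , []) R))

  lhs≤maxLhsLength : ∀ {l r} → (l , r) ∈ R → length l ≤ maxLhsLength
  lhs≤maxLhsLength = All.lookup (f[xs]≤f[argmax] ([] , []) R)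

  LhsFits : Str k → Str k → Set
  LhsFits s z = s ≡ [] ⊎ maxLhsLength ≤ length z

  endStep-local : ∀ s z {t} → LhsFits s z → EndStep (s ++ z) t → ∃[ t' ] (EndStep z t' × t ≡ s ++ t')
  endStep-local [] _ _           step = _ , step , refl
  endStep-local s  z (inj₂ long) (x , l , r , lr∈R , s++z≡ , refl)
    with c , z≡ , refl ← ++-split-at-suffix s z x l s++z≡ (≤-trans (lhs≤maxLhsLength lr∈R) long) =
    c ++ r , (c , l , r , lr∈R , z≡ , refl) , ++-assoc s c r

  ∷ʳ-step-local : ∀ s b {a t} → LhsFits s b → Irr (s ++ b) →
                  (s ++ b) ∷ʳ a ⟶ᴿ t → ∃[ t' ] (b ∷ʳ a ⟶ᴿ t' × t ≡ s ++ t')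
  ∷ʳ-step-local s b {a} fits irr step
    with t' , end , refl ← endStep-local s (b ∷ʳ a)
                             (Sum.map₂ (λ long → ≤-trans long (length≤length-∷ʳ b)) fits)
                             (subst (λ z → EndStep z _) (++-assoc s b [ a ]) (∷ʳ-step⇒endStep irr step)) =
    t' , endStep⇒step end , refl

module AppendLetter {k : ℕ} (R : SRS k) (conf : Confluent R) (fc : ForwardClosed R) where

  open StringRewriting R

  appendNF : Str k → Fin k → Str k
  appendNF b a with irreducible? b | redex? (b ∷ʳ a)
  ... | yes irr | yes redex = proj₁ (fc (b ∷ʳ a) (∷ʳ-redex⇒innermost irr redex))
  ... | _       | _         = b ∷ʳ a

  appendNF-spec : ∀ b a → Irr b →
                  (b ∷ʳ a ≡ appendNF b a ⊎ b ∷ʳ a ⟶ᴿ appendNF b a) × Irr (appendNF b a)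
  appendNF-spec b a irr with irreducible? b | redex? (b ∷ʳ a)
  ... | yes irr | yes redex =
    let _ , step , irr-nf = fc (b ∷ʳ a) (∷ʳ-redex⇒innermost irr redex) in inj₂ step , irr-nf
  ... | yes irr | no ¬redex = inj₁ refl , irreducible-∷ʳ irr ¬redex
  ... | no ¬irr | _         = ⊥-elim (¬irr irr)

  ∷ʳ-step-irreducible-in-context : ∀ s b {a y} → LhsFits s b → Irr (s ++ b) →
                                   b ∷ʳ a ⟶ᴿ y → Irr y → Irr (s ++ y)
  ∷ʳ-step-irreducible-in-context s b fits irr step irr-y
    with Y , step-Y , irr-Y ←
           fc _ (∷ʳ-redex⇒innermost irr (endStep⇒redex (∷ʳ-step⇒endStep irr (⟶-∷ʳ-++ˡ s step))))
    with t' , step-t' , refl ← ∷ʳ-step-local s b fits irr step-Y =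
    subst (λ y → Irr (s ++ y))
          (sym (normalForm-unique conf (step ◅ ε) (step-t' ◅ ε) irr-y (irreducible-++⁻ʳ s t' irr-Y)))
          irr-Y

  appendNF-in-context : ∀ s b a → LhsFits s b → Irr (s ++ b) →
                        (s ++ b) ∷ʳ a ⟶ᴿ* s ++ appendNF b a × Irr (s ++ appendNF b a)
  appendNF-in-context s b a fits irr with appendNF-spec b a (irreducible-++⁻ʳ s b irr)
  ... | inj₁ no-step , irr-nf =
    subst ((s ++ b) ∷ʳ a ⟶ᴿ*_) (trans (++-assoc s b [ a ]) (cong (s ++_) no-step)) ε ,
    λ t step →
      let t' , step' , _ = ∷ʳ-step-local s b fits irr
                             (subst (_⟶ᴿ t) (sym (trans (++-assoc s b [ a ]) (cong (s ++_) no-step))) step)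
      in irr-nf t' (subst (_⟶ᴿ t') no-step step')
  ... | inj₂ step , irr-nf = ⟶-∷ʳ-++ˡ s step ◅ ε , ∷ʳ-step-irreducible-in-context s b fits irr step irr-nf

module Recogniser {k : ℕ} (R : SRS k) (conf : Confluent R) (fc : ForwardClosed R)
                  (u v : Str k) (irr-u : Irreducible R u) where

  open StringRewriting R
  open AppendLetter R conf fc

  Letter : Set
  Letter = Fin k ⊎ ⊤

  pattern # = inj₂ tt

  -- zero marks the bottom of the stack, suc a stands for the letter a
  Γ : Set
  Γ = Fin (suc k)

  stack : Str k → List Γ
  stack []      = [ zero ]
  stack (c ∷ r) = suc c ∷ stack r

  -- the flag of reading records whether a letter has been read
  data State : Set where
    start accept : State
    reading      : Bool → Str k → State
    checking     : Str k → State

  -- a letter on top of the stack is moved into a buffer that is too short to read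
  Refilling : Γ → Str k → Set
  Refilling zero    _ = ⊥
  Refilling (suc _) b = length b < maxLhsLength

  refilling? : ∀ Z b → Dec (Refilling Z b)
  refilling? zero    _ = no λ ()
  refilling? (suc _) b = length b <? maxLhsLength

  spilled kept : Str k → Str k
  spilled y = reverse (take (length y ∸ maxLhsLength) y)
  kept    y = drop (length y ∸ maxLhsLength) y

  consume : Bool → Str k → Letter → Γ → Maybe (State × List Γ)
  consume _     b (inj₁ a) Z = just (reading true (kept (appendNF b a)) , map suc (spilled (appendNF b a)) ++ [ Z ])
  consume true  b #        Z = just (checking b , [ Z ])
  consume false b #        Z = nothing

  δ : State → Maybe Letter → Γ → Maybe (State × List Γ)
  δ start         nothing  zero    = just (reading false [] , stack (reverse u))
  δ (reading f b) nothing  (suc c) = when (length b <? maxLhsLength) (just (reading f (c ∷ b) , []))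
  δ (reading f b) (just x) Z       = unless (refilling? Z b) (consume f b x Z)
  δ (checking b)  nothing  (suc c) = when (length b <? length v) (just (checking (c ∷ b) , []))
  δ (checking b)  nothing  zero    = when (≡-dec Fin._≟_ b v) (just (accept , []))
  δ _             _        _       = nothing

  deterministic : ∀ q Z → Is-just (δ q nothing Z) → ∀ a → δ q (just a) Z ≡ nothing
  deterministic start         _       _    _ = refl
  deterministic (reading f b) (suc c) move _ =
    unless-holds (length b <? maxLhsLength) (when-is-just (length b <? maxLhsLength) move)
  deterministic (checking b)  _       _    _ = refl

  isAccept : State → Bool
  isAccept accept = true
  isAccept _      = false

  M : AbstractDPDA Letter
  M = record { State = State ; nΓ = suc k ; start = start ; Z₀ = zero ; final = isAccept
             ; δ = δ ; deterministic = deterministic }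

  open AbstractDPDA M using (Config; _⊢_; Accepts; read; eps)

  stack-++ : ∀ E {Z stk} r → Z ∷ stk ≡ stack r → (map suc E ++ [ Z ]) ++ stk ≡ stack (E ++ r)
  stack-++ []      r eq = eq
  stack-++ (c ∷ E) r eq = cong (suc c ∷_) (stack-++ E r eq)

  reverse-∷-++ : ∀ (c : Fin k) r b → reverse (c ∷ r) ++ b ≡ reverse r ++ c ∷ b
  reverse-∷-++ c r b = trans (cong (_++ b) (unfold-reverse c r)) (∷ʳ-++ (reverse r) c b)

  spilled-kept : ∀ y r → reverse (spilled y ++ r) ++ kept y ≡ reverse r ++ y
  spilled-kept y r = begin
    reverse (spilled y ++ r) ++ kept y           ≡⟨ cong (_++ kept y) (reverse-++ (spilled y) r) ⟩
    (reverse r ++ reverse (spilled y)) ++ kept y ≡⟨ cong (λ z → (reverse r ++ z) ++ kept y)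
                                                         (reverse-involutive _) ⟩
    (reverse r ++ take d y) ++ drop d y          ≡⟨ ++-assoc (reverse r) _ _ ⟩
    reverse r ++ take d y ++ drop d y            ≡⟨ cong (reverse r ++_) (take++drop≡id d y) ⟩
    reverse r ++ y                               ∎
    where
      open ≡-Reasoning
      d = length y ∸ maxLhsLength

  kept-length : ∀ y → length (kept y) ≤ maxLhsLength
  kept-length y =
    subst (_≤ maxLhsLength) (sym (length-drop (length y ∸ maxLhsLength) y))
          (m∸[m∸n]≤n (length y) maxLhsLength)

  Ready : Str k → Str k → Set
  Ready r b = r ≡ [] ⊎ maxLhsLength ≤ length b

  ready-unless-refilling : ∀ {Z stk b} r → Z ∷ stk ≡ stack r → ¬ Refilling Z b → Ready r b
  ready-unless-refilling []      _    _       = inj₁ refl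
  ready-unless-refilling (_ ∷ _) refl ¬refill = inj₂ (≮⇒≥ ¬refill)

  Stores : Str k → List Γ → Str k → Set
  Stores w st b = ∃[ r ] (st ≡ stack r × (u ++ w) ⟶ᴿ! (reverse r ++ b))

  stores-start : Stores [] (stack (reverse u) ++ []) []
  stores-start = reverse u , ++-identityʳ _ ,
    subst (λ z → (u ++ []) ⟶ᴿ! (z ++ [])) (sym (reverse-involutive u))
          (ε , subst Irr (sym (++-identityʳ u)) irr-u)

  stores-pop : ∀ {w c stk b} → Stores w (suc c ∷ stk) b → Stores w stk (c ∷ b)
  stores-pop {w} {c} {b = b} (c ∷ r , refl , nf) = r , refl , subst ((u ++ w) ⟶ᴿ!_) (reverse-∷-++ c r b) nf

  stores-bottom : ∀ {w stk b} → Stores w (zero ∷ stk) b → (u ++ w) ⟶ᴿ! b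
  stores-bottom ([] , refl , nf) = nf

  stores-append : ∀ {w Z stk b} a → ¬ Refilling Z b → Stores w (Z ∷ stk) b →
    Stores (w ∷ʳ a) ((map suc (spilled (appendNF b a)) ++ [ Z ]) ++ stk) (kept (appendNF b a))
  stores-append {w} {b = b} a ¬refill (r , st≡ , steps , irr)
    with steps' , irr' ← appendNF-in-context (reverse r) b a
                           (Sum.map₁ (cong reverse) (ready-unless-refilling r st≡ ¬refill)) irr =
    spilled y ++ r , stack-++ (spilled y) r st≡ ,
    subst₂ _⟶ᴿ*_ (++-assoc u w [ a ]) (sym (spilled-kept y r)) (⟶*-++ʳ [ a ] steps ◅◅ steps') ,
    subst Irr (sym (spilled-kept y r)) irr'
    where
      y = appendNF b a

  module Invariant (x : List Letter) where

    Inv : Config → Set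
    Inv (start ,       rest , st) = rest ≡ x × st ≡ [ zero ]
    Inv (reading f b , rest , st) = ∃[ w ] (x ≡ map inj₁ w ++ rest × Stores w st b × (f ≡ true → w ≢ []))
    Inv (checking b ,  rest , st) = ∃[ w ] (x ≡ map inj₁ w ++ # ∷ rest × Stores w st b × w ≢ [])
    Inv (accept ,      rest , _)  = ∃[ w ] (x ≡ map inj₁ w ++ # ∷ rest × w ≢ [] × (u ++ w) ⟶ᴿ! v)

    ⊢-preserves : ∀ {c c'} → Inv c → c ⊢ c' → Inv c'
    ⊢-preserves {start , _ , _} (refl , refl) (eps {Z = zero} refl) = [] , refl , stores-start , λ ()
    ⊢-preserves {reading f b , _ , _} (w , x≡ , stores , flag) (eps {Z = suc c} eq)
      with _ , refl ← when-just (length b <? maxLhsLength) eq = w , x≡ , stores-pop stores , flag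
    ⊢-preserves {reading f b , _ , _} (w , x≡ , stores , _) (read {a = inj₁ a} {w = rest} {Z = Z} eq)
      with ¬refill , refl ← unless-just (refilling? Z b) eq =
      w ∷ʳ a ,
      trans x≡ (sym (trans (cong (_++ rest) (map-++ inj₁ w [ a ])) (∷ʳ-++ (map inj₁ w) (inj₁ a) rest))) ,
      stores-append a ¬refill stores , λ _ → ∷ʳ≢[] w
    ⊢-preserves {reading true b , _ , _} (w , x≡ , stores , flag) (read {a = #} {Z = Z} eq)
      with _ , refl ← unless-just (refilling? Z b) eq = w , x≡ , stores , flag refl
    ⊢-preserves {reading false b , _ , _} _ (read {a = #} {Z = Z} eq)
      with _ , () ← unless-just (refilling? Z b) eq
    ⊢-preserves {checking b , _ , _} (w , x≡ , stores , w≢[]) (eps {Z = suc c} eq)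
      with _ , refl ← when-just (length b <? length v) eq = w , x≡ , stores-pop stores , w≢[]
    ⊢-preserves {checking b , _ , _} (w , x≡ , stores , w≢[]) (eps {Z = zero} eq)
      with refl , refl ← when-just (≡-dec Fin._≟_ b v) eq = w , x≡ , w≢[] , stores-bottom stores

    ⊢*-preserves : ∀ {c c'} → Inv c → Star _⊢_ c c' → Inv c'
    ⊢*-preserves inv ε              = inv
    ⊢*-preserves inv (step ◅ steps) = ⊢*-preserves (⊢-preserves inv step) steps

    accepts⇒member : Accepts x → L[ R , u , v ] x
    accepts⇒member (accept , _ , run , _) = ⊢*-preserves (refl , refl) run

  read-pushing : ∀ {q x rest Z stk q' γ st} → δ q (just x) Z ≡ just (q' , γ) → γ ++ stk ≡ st →
                 (q , x ∷ rest , Z ∷ stk) ⊢ (q' , rest , st)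
  read-pushing eq refl = read eq

  eps-pushing : ∀ {q x Z stk q' γ st} → δ q nothing Z ≡ just (q' , γ) → γ ++ stk ≡ st →
                (q , x , Z ∷ stk) ⊢ (q' , x , st)
  eps-pushing eq refl = eps eq

  refill* : ∀ f b r rest → ∃[ b' ] ∃[ r' ]
            (Star _⊢_ (reading f b , rest , stack r) (reading f b' , rest , stack r') × Ready r' b')
  refill* f b []      rest = b , [] , ε , inj₁ refl
  refill* f b (c ∷ r) rest with length b <? maxLhsLength
  ... | no ¬short = b , c ∷ r , ε , inj₂ (≮⇒≥ ¬short)
  ... | yes short with b' , r' , run , ready ← refill* f (c ∷ b) r rest =
    b' , r' , eps (when-holds (length b <? maxLhsLength) short) ◅ run , ready

  read-letter : ∀ {f b a rest} r → Ready r b →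
    (reading f b , inj₁ a ∷ rest , stack r) ⊢
    (reading true (kept (appendNF b a)) , rest , stack (spilled (appendNF b a) ++ r))
  read-letter {b = b} {a} []      _           = read-pushing refl (stack-++ (spilled (appendNF b a)) [] refl)
  read-letter {b = b} {a} (c ∷ r) (inj₂ long) =
    read-pushing (unless-fails (length b <? maxLhsLength) (≤⇒≯ long))
                 (stack-++ (spilled (appendNF b a)) (c ∷ r) refl)

  read-letter-refill : ∀ a f b r rest → Ready r b → ∃[ b' ] ∃[ r' ]
    (Star _⊢_ (reading f b , inj₁ a ∷ rest , stack r) (reading true b' , rest , stack r') × Ready r' b')
  read-letter-refill a f b r rest ready
    with b' , r' , run , ready' ← refill* true (kept (appendNF b a)) (spilled (appendNF b a) ++ r) rest =
    b' , r' , read-letter r ready ◅ run , ready'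

  read-word : ∀ a w f b r rest → Ready r b → ∃[ b' ] ∃[ r' ]
    (Star _⊢_ (reading f b , map inj₁ (a ∷ w) ++ rest , stack r) (reading true b' , rest , stack r') ×
     Ready r' b')
  read-word a []       f b r rest ready = read-letter-refill a f b r rest ready
  read-word a (a' ∷ w) f b r rest ready
    with b₁ , r₁ , run₁ , ready₁ ← read-letter-refill a f b r (map inj₁ (a' ∷ w) ++ rest) ready
    with b₂ , r₂ , run₂ , ready₂ ← read-word a' w true b₁ r₁ rest ready₁ =
    b₂ , r₂ , run₁ ◅◅ run₂ , ready₂

  read-# : ∀ {b rest} r → Ready r b → (reading true b , # ∷ rest , stack r) ⊢ (checking b , rest , stack r)
  read-# []                _           = read refl
  read-# {b = b} (c ∷ r) (inj₂ long) = read (unless-fails (length b <? maxLhsLength) (≤⇒≯ long))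

  check* : ∀ r b → reverse r ++ b ≡ v → Star _⊢_ (checking b , [] , stack r) (accept , [] , [])
  check* []      b refl = eps (when-holds (≡-dec Fin._≟_ b b) refl) ◅ ε
  check* (c ∷ r) b eq   = eps (when-holds (length b <? length v) b<v) ◅ check* r (c ∷ b) eq'
    where
      eq' : reverse r ++ c ∷ b ≡ v
      eq' = trans (sym (reverse-∷-++ c r b)) eq
      b<v : length b < length v
      b<v = subst (λ z → length b < length z) eq'
                  (subst (length b <_) (sym (length-++ (reverse r))) (m≤n+m (suc (length b)) (length (reverse r))))

  -- the invariant identifies the string stored on reaching checking as the normal form of u w
  checking-accepts : ∀ {x w b st} → Invariant.Inv x (checking b , [] , st) → x ≡ map inj₁ w ++ [ # ] →
                     (u ++ w) ⟶ᴿ! v → Star _⊢_ (checking b , [] , st) (accept , [] , [])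
  checking-accepts {w = w} {b} (w' , refl , (r , refl , steps' , irr') , _) x≡ (steps , irr)
    with refl ← map-injective inj₁-injective (∷ʳ-injectiveˡ (map inj₁ w') (map inj₁ w) x≡) =
    check* r b (normalForm-unique conf steps' steps irr' irr)

  member⇒accepts : ∀ x → L[ R , u , v ] x → Accepts x
  member⇒accepts _ ([] , _ , w≢[] , _) = ⊥-elim (w≢[] refl)
  member⇒accepts x (a ∷ w , refl , _ , nf)
    with b₁ , r₁ , run₁ , ready₁ ← refill* false [] (reverse u) x
    with b₂ , r₂ , run₂ , ready₂ ← read-word a w false b₁ r₁ [ # ] ready₁ =
    accept , [] , run ◅◅ checking-accepts (Invariant.⊢*-preserves x (refl , refl) run) refl nf , refl
    where
      run : Star _⊢_ (start , x , [ zero ]) (checking b₂ , [] , stack r₂)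
      run = eps-pushing refl (++-identityʳ _) ◅ run₁ ◅◅ run₂ ◅◅ read-# r₂ ready₂ ◅ ε

  N : ℕ
  N = maxLhsLength + length v

  Bounded : State → Set
  Bounded (reading _ b) = length b ≤ N
  Bounded (checking b)  = length b ≤ N
  Bounded _             = ⊤

  δ-bounded : ∀ {q m Z q' γ} → Bounded q → δ q m Z ≡ just (q' , γ) → Bounded q'
  δ-bounded {start}           {nothing}       {zero}  _ refl = z≤n
  δ-bounded {reading f b}     {nothing}       {suc c} _ eq
    with short , refl ← when-just (length b <? maxLhsLength) eq = ≤-trans short (m≤m+n _ _)
  δ-bounded {reading f b}     {just (inj₁ a)} {Z}     _ eq
    with _ , refl ← unless-just (refilling? Z b) eq = ≤-trans (kept-length (appendNF b a)) (m≤m+n _ _)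
  δ-bounded {reading true b}  {just #}        {Z}     bounded eq
    with _ , refl ← unless-just (refilling? Z b) eq = bounded
  δ-bounded {reading false b} {just #}        {Z}     _ eq
    with _ , () ← unless-just (refilling? Z b) eq
  δ-bounded {checking b}      {nothing}       {suc c} _ eq
    with short , refl ← when-just (length b <? length v) eq = ≤-trans short (m≤n+m _ _)
  δ-bounded {checking b}      {nothing}       {zero}  _ eq
    with _ , refl ← when-just (≡-dec Fin._≟_ b v) eq = tt

  open BoundedLists k

  buffered : Fin 3 → Str k → State
  buffered zero             = reading false
  buffered (suc zero)       = reading true
  buffered (suc (suc zero)) = checking

  size : ℕ
  size = 2 + 3 * codeSize N

  encodeBuffered : Fin 3 → Str k → Fin size
  encodeBuffered t b = suc (suc (combine t (encodeList N b)))

  encode : State → Fin size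
  encode start             = zero
  encode accept            = suc zero
  encode (reading false b) = encodeBuffered zero b
  encode (reading true b)  = encodeBuffered (suc zero) b
  encode (checking b)      = encodeBuffered (suc (suc zero)) b

  decodeBuffered : Fin 3 × Fin (codeSize N) → State
  decodeBuffered (t , j) = buffered t (decodeList N j)

  decode : Fin size → State
  decode zero          = start
  decode (suc zero)    = accept
  decode (suc (suc i)) = decodeBuffered (remQuot {3} (codeSize N) i)

  decode-encodeBuffered : ∀ t b → length b ≤ N → decode (encodeBuffered t b) ≡ buffered t b
  decode-encodeBuffered t b b≤N =
    trans (cong decodeBuffered (remQuot-combine {3} {codeSize N} t (encodeList N b)))
          (cong (buffered t) (decodeList-encodeList N b b≤N))

  decode-encode : ∀ {q} → Bounded q → decode (encode q) ≡ q
  decode-encode {start}           _   = refl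
  decode-encode {accept}          _   = refl
  decode-encode {reading false b} b≤N = decode-encodeBuffered zero b b≤N
  decode-encode {reading true b}  b≤N = decode-encodeBuffered (suc zero) b b≤N
  decode-encode {checking b}      b≤N = decode-encodeBuffered (suc (suc zero)) b b≤N

  presentation : FinitePresentation M
  presentation = record
    { Bounded = Bounded ; size = size ; encode = encode ; decode = decode
    ; decode-encode = decode-encode ; start-bounded = tt ; δ-bounded = δ-bounded }

lemma7 : ∀ {k : ℕ} (R : SRS k) → Convergent R → RightReduced R → ForwardClosed R →
         ∀ (u v : Str k) → Irreducible R u → Irreducible R v →
         IsDCFL L[ R , u , v ]
lemma7 R (_ , conf) _ fc u v irr-u _ =
  toDPDA M presentation ,
  λ x → mk⇔ (Equivalence.to (toDPDA-accepts M presentation x) ∘ member⇒accepts x)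
            (Invariant.accepts⇒member x ∘ Equivalence.from (toDPDA-accepts M presentation x))
  where open Recogniser R conf fc u v irr-u
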